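{- Both $\mathbf{FinLO}$ and $\mathbf{FintLO}$ are full cofinal subcategories of $\mathbf{FinaLO}$, and $\mathbf{FinaLO}=\mathbf{FinLO}\cup\mathbf{FintLO}$. A $\mathbf{FinaLO}$-object is amalgamable if and only if it is a linear order. A $\mathbf{FinaLO}$-arrow is amalgamable if and only if it factorizes through a linear order, which happens if and only if it is not of the form $f+B:L+B\to L'+B$ for a $\mathbf{FinLO}$-arrow $f:L\to L'$. Consequently $\mathbf{FinaLO}$ is an amalgamation extension of $\mathbf{FintLO}$.
   Context: A partial order is almost linear if every three-element subset has a minimum. $\mathbf{FinaLO}$ is the category of finite almost linear orders and injective order-preserving maps; $\mathbf{FinLO}$ is its full subcategory of finite linear orders (whose morphisms are exactly the order embeddings). $B$ denotes a two-element antichain, and for orders $X,Y$, $X+Y$ is the ordered sum (disjoint union with every element of $X$ below every element of $Y$); every finite almost linear order is either linear or of the form $L+B$ with $L$ linear; $f+B$ denotes $f$ extended by the identity on $B$. $\mathbf{FintLO}$ is the category of finite structures $(X,R)$, $R$ ternary, satisfying: $R(x,y,z)\Rightarrow|\{x,y,z\}|=3$; $R(x,y,z)\Leftrightarrow R(x,z,y)$; $R(x,y,w)\wedge R(y,z,w')\Rightarrow R(x,z,w')$; $|\{x,y,z\}|=3\Rightarrow R(x,y,z)\vee R(y,z,x)\vee R(z,x,y)$, with first-order embeddings; it is identified with a full subcategory of $\mathbf{FinaLO}$ via $(X,R)\mapsto(X,\le)$ with $x<y\iff\exists w\,R(x,y,w)$; under this identification its objects are the finite almost linear orders with at most one element together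 with those of the form $L+B$. An arrow $e:z\to z'$ is amalgamable if for all $f:z'\to x$, $g:z'\to y$ there are $f',g'$ with $f'\circ f\circ e=g'\circ g\circ e$; an object is amalgamable if its identity is. A subcategory is cofinal if every object of the larger category has an arrow into one of its objects. $\mathfrak C'\supseteq\mathfrak C$ is an amalgamation extension of $\mathfrak C$ if $\mathfrak C$ is full and cofinal in $\mathfrak C'$, every $\mathfrak C'$-object not in $\mathfrak C$ is amalgamable in $\mathfrak C'$, and every amalgamable $\mathfrak C$-arrow factorizes through an amalgamable $\mathfrak C'$-object. -}

module Defs where

open import Data.Nat using (ℕ)
open import Data.Fin using (Fin; _≟_)
open import Data.Fin.Properties using (any?)
open import Data.Product using (Σ; ∃; _×_; _,_; proj₁; proj₂)
open import Data.Sum using (_⊎_; inj₁; inj₂)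
open import Data.Empty using (⊥-elim)
open import Relation.Nullary using (¬_; Dec; yes; no)
open import Relation.Nullary.Decidable using (_⊎-dec_)
open import Relation.Binary.PropositionalEquality using (_≡_; _≢_; refl; sym; trans; subst; cong)
open import Function.Bundles using (_⇔_; mk⇔; Equivalence)

-- Finite partial orders, carried by Fin n (every finite order is
-- isomorphic to one of these).  The order is required to be decidable
-- (automatic classically for finite orders).

Distinct3 : ∀ {n} → Fin n → Fin n → Fin n → Set
Distinct3 x y z = (x ≢ y) × (y ≢ z) × (x ≢ z)

record FinPoset : Set₁ where
  field
    size      : ℕ
    _≼_       : Fin size → Fin size → Set
    ≼-dec     : ∀ x y → Dec (x ≼ y)
    ≼-refl    : ∀ x → x ≼ x
    ≼-antisym : ∀ {x y} → x ≼ y → y ≼ x → x ≡ y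
    ≼-trans   : ∀ {x y z} → x ≼ y → y ≼ z → x ≼ z

AlmostLinear : FinPoset → Set
AlmostLinear P = ∀ x y z → Distinct3 x y z →
    ((x ≼ y) × (x ≼ z)) ⊎ ((y ≼ x) × (y ≼ z)) ⊎ ((z ≼ x) × (z ≼ y))
  where open FinPoset P

record ALO : Set₁ where
  field
    poset        : FinPoset
    almostLinear : AlmostLinear poset
  open FinPoset poset public

open ALO public using (size)

module _ (X : ALO) where
  open ALO X
  Linear : Set
  Linear = ∀ x y → (x ≼ y) ⊎ (y ≼ x)

record IsHom (X Y : ALO) (f : Fin (size X) → Fin (size Y)) : Set where
  field
    inj  : ∀ {a b} → f a ≡ f b → a ≡ b
    mono : ∀ {a b} → ALO._≼_ X a b → ALO._≼_ Y (f a) (f b)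

record Hom (X Y : ALO) : Set where
  constructor hom
  field
    fun   : Fin (size X) → Fin (size Y)
    isHom : IsHom X Y fun
open Hom public

-- order embeddings (the arrows of FinLO by definition)
IsOrderEmbedding : (X Y : ALO) → (Fin (size X) → Fin (size Y)) → Set
IsOrderEmbedding X Y f =
  (∀ {a b} → f a ≡ f b → a ≡ b) × (∀ a b → ALO._≼_ X a b ⇔ ALO._≼_ Y (f a) (f b))

_≈_ : ∀ {X Y} → Hom X Y → Hom X Y → Set
f ≈ g = ∀ x → fun f x ≡ fun g x

idH : (X : ALO) → Hom X X
idH X = hom (λ x → x) (record { inj = λ e → e ; mono = λ le → le })

_∘H_ : ∀ {X Y Z} → Hom Y Z → Hom X Y → Hom X Z
g ∘H f = hom (λ x → fun g (fun f x))
  (record { inj = λ e → IsHom.inj (isHom f) (IsHom.inj (isHom g) e)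
          ; mono = λ le → IsHom.mono (isHom g) (IsHom.mono (isHom f) le) })

Iso : ALO → ALO → Set
Iso X Y = Σ (Hom X Y) λ f → Σ (Hom Y X) λ g → ((g ∘H f) ≈ idH X) × ((f ∘H g) ≈ idH Y)

module Amalg {Obj : Set₁} (Hom' : Obj → Obj → Set)
  (_∘'_ : ∀ {a b c} → Hom' b c → Hom' a b → Hom' a c)
  (_≈'_ : ∀ {a b} → Hom' a b → Hom' a b → Set) where

  AmalgamableArrow : ∀ {z z'} → Hom' z z' → Set₁
  AmalgamableArrow {z} {z'} e =
    ∀ {x y} (f : Hom' z' x) (g : Hom' z' y) →
      Σ Obj λ w → Σ (Hom' x w) λ f' → Σ (Hom' y w) λ g' →
        ((f' ∘' f) ∘' e) ≈' ((g' ∘' g) ∘' e)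

AmalgamableArrow : ∀ {Z Z'} → Hom Z Z' → Set₁
AmalgamableArrow = Amalg.AmalgamableArrow Hom _∘H_ _≈_

AmalgamableObj : ALO → Set₁
AmalgamableObj X = AmalgamableArrow (idH X)

FactorsThroughLinear : ∀ {Z Z'} → Hom Z Z' → Set₁
FactorsThroughLinear {Z} {Z'} e =
  Σ ALO λ Y → Linear Y × Σ (Hom Z Y) λ g → Σ (Hom Y Z') λ h → (h ∘H g) ≈ e

-- Decomposition X ≅ L + B : two incomparable top elements p, q, the rest
-- (= L) linearly ordered and below both p and q.

record LplusB (X : ALO) : Set where
  open ALO X
  field
    p q      : Fin (ALO.size X)
    p≢q      : p ≢ q
    p⋠q      : ¬ (p ≼ q)
    q⋠p      : ¬ (q ≼ p)
    L-below  : ∀ x → x ≢ p → x ≢ q → (x ≼ p) × (x ≼ q)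
    L-linear : ∀ x y → x ≢ p → x ≢ q → y ≢ p → y ≢ q → (x ≼ y) ⊎ (y ≼ x)

-- e is of the form f + B : L + B → L' + B (f : L → L', identity on B)
IsFPlusB : ∀ {Z Z'} → Hom Z Z' → Set
IsFPlusB {Z} {Z'} e =
  Σ (LplusB Z) λ d → Σ (LplusB Z') λ d' →
    (fun e (LplusB.p d) ≡ LplusB.p d') × (fun e (LplusB.q d) ≡ LplusB.q d') ×
    (∀ x → x ≢ LplusB.p d → x ≢ LplusB.q d →
       (fun e x ≢ LplusB.p d') × (fun e x ≢ LplusB.q d'))

-- FintLO: finite ternary structures

record TStr : Set₁ where
  field
    size       : ℕ
    R          : Fin size → Fin size → Fin size → Set
    R-dec      : ∀ x y z → Dec (R x y z)
    R-distinct : ∀ {x y z} → R x y z → Distinct3 x y z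
    R-swap     : ∀ x y z → R x y z ⇔ R x z y
    R-trans    : ∀ {x y z w w'} → R x y w → R y z w' → R x z w'
    R-total    : ∀ x y z → Distinct3 x y z → R x y z ⊎ R y z x ⊎ R z x y

record IsEmb (S T : TStr) (f : Fin (TStr.size S) → Fin (TStr.size T)) : Set where
  field
    inj  : ∀ {a b} → f a ≡ f b → a ≡ b
    pres : ∀ x y z → TStr.R S x y z ⇔ TStr.R T (f x) (f y) (f z)

record Emb (S T : TStr) : Set where
  constructor emb
  field
    efun  : Fin (TStr.size S) → Fin (TStr.size T)
    isEmb : IsEmb S T efun
open Emb public

_≈E_ : ∀ {S T} → Emb S T → Emb S T → Set
f ≈E g = ∀ x → efun f x ≡ efun g x

_∘E_ : ∀ {S T U} → Emb T U → Emb S T → Emb S U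
g ∘E f = emb (λ x → efun g (efun f x))
  (record { inj = λ e → IsEmb.inj (isEmb f) (IsEmb.inj (isEmb g) e)
          ; pres = λ x y z → mk⇔
              (λ r → Equivalence.to (IsEmb.pres (isEmb g) _ _ _) (Equivalence.to (IsEmb.pres (isEmb f) x y z) r))
              (λ r → Equivalence.from (IsEmb.pres (isEmb f) x y z) (Equivalence.from (IsEmb.pres (isEmb g) _ _ _) r)) })

AmalgamableInFintLO : ∀ {S S'} → Emb S S' → Set₁
AmalgamableInFintLO = Amalg.AmalgamableArrow Emb _∘E_ _≈E_

module _ (S : TStr) where
  open TStr S renaming (size to sz)

  _≼T_ : Fin sz → Fin sz → Set
  x ≼T y = (x ≡ y) ⊎ ∃ λ w → R x y w

  private
    dec : ∀ x y → Dec (x ≼T y)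
    dec x y = (x ≟ y) ⊎-dec any? (λ w → R-dec x y w)

    antisym : ∀ {x y} → x ≼T y → y ≼T x → x ≡ y
    antisym (inj₁ e) _ = e
    antisym (inj₂ _) (inj₁ e) = sym e
    antisym (inj₂ (w , r)) (inj₂ (w' , r')) =
      ⊥-elim (proj₁ (R-distinct (R-trans r r')) refl)

    tr : ∀ {x y z} → x ≼T y → y ≼T z → x ≼T z
    tr (inj₁ refl) b = b
    tr (inj₂ a) (inj₁ refl) = inj₂ a
    tr (inj₂ (w , r)) (inj₂ (w' , r')) = inj₂ (w' , R-trans r r')

    poset : FinPoset
    poset = record
      { size = sz ; _≼_ = _≼T_ ; ≼-dec = dec ; ≼-refl = λ _ → inj₁ refl
      ; ≼-antisym = antisym ; ≼-trans = tr }

    al : AlmostLinear poset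
    al x y z d with R-total x y z d
    ... | inj₁ r = inj₁ (inj₂ (z , r) , inj₂ (y , Equivalence.to (R-swap _ _ _) r))
    ... | inj₂ (inj₁ r) = inj₂ (inj₁ (inj₂ (z , Equivalence.to (R-swap _ _ _) r) , inj₂ (x , r)))
    ... | inj₂ (inj₂ r) = inj₂ (inj₂ (inj₂ (y , r) , inj₂ (x , Equivalence.to (R-swap _ _ _) r)))

  toALO : ALO
  toALO = record { poset = poset ; almostLinear = al }

InFintLO : ALO → Set₁
InFintLO X = Σ TStr λ S → Iso X (toALO S)

-- An almost linear order has at most one incomparable pair {p, q}, and everything else lies
-- below both p and q; so it is linear or of the form L + B.  The heart of the matter is that an
-- arrow e is amalgamable exactly when its image is a chain.  If e p and e q are incomparable,
-- the two linear extensions of the target placing e p below e q, respectively above it, cannot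
-- be amalgamated over e; as L embeds in L + B, these extensions can be taken inside FintLO, which
-- settles FintLO as well.  If the image is a chain, pulling the target order back along e
-- factors e through a linear order, and linear orders are amalgamable: two linear orders over a
-- common linear suborder are interleaved according to how many points of the suborder lie below
-- each element.

module Submission where

open import Defs
open import Data.Nat using (ℕ; _+_; _≤_; _<_; _≤?_; _<?_)
open import Data.Nat.Properties using (≤-antisym; ≤-trans; <⇒≱; ≤-<-trans; <-≤-trans; ≰⇒>)
open import Data.Fin using (Fin; zero; suc; _≟_; splitAt; join; _↑ˡ_; _↑ʳ_)
open import Data.Fin.Properties
  using (all?; any?; ¬∀⟶∃¬; splitAt-join; join-splitAt; splitAt-↑ˡ; splitAt-↑ʳ; ↑ˡ-injective)
open import Data.Fin.Subset using (Subset; _∈_; _⊆_; ∣_∣)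
open import Data.Fin.Subset.Properties using (p⊆q⇒∣p∣≤∣q∣; p⊂q⇒∣p∣<∣q∣)
open import Data.Vec using (tabulate)
open import Data.Vec.Properties using (lookup∘tabulate; []=⇒lookup; lookup⇒[]=)
open import Data.Bool.Properties using (T-≡)
open import Data.Product using (Σ; ∃; ∃₂; _×_; _,_; proj₁; proj₂; swap)
import Data.Product as Product
open import Data.Sum using (_⊎_; inj₁; inj₂; [_,_]′)
import Data.Sum as Sum
open import Data.Sum.Relation.Binary.LeftOrder
  using (_⊎-<_; ₁∼₁; ₁∼₂; ₂∼₂; drop-inj₂; ⊎-<-refl; ⊎-<-transitive; ⊎-<-antisymmetric; ⊎-<-decidable)
open import Data.Sum.Properties using (inj₁-injective; inj₂-injective)
open import Data.Sum.Relation.Binary.Pointwise using (Pointwise-≡⇒≡)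
open import Data.Empty using (⊥-elim)
open import Function using (_∘_; id)
open import Relation.Binary.Definitions using (Total; Transitive)
open import Relation.Nullary using (¬_; Dec; yes; no)
open import Relation.Nullary.Decidable using (_⊎-dec_; _×-dec_; ¬?; isYes; toWitness; fromWitness)
open import Relation.Binary.PropositionalEquality using (_≡_; _≢_; refl; sym; trans; cong; subst; subst₂)
open import Function.Bundles using (_⇔_; mk⇔; Equivalence)

module _ (X : ALO) where
  open ALO X hiding (size)

  Comparable Incomparable : Fin (size X) → Fin (size X) → Set
  Comparable x y = x ≼ y ⊎ y ≼ x
  Incomparable x y = ¬ x ≼ y × ¬ y ≼ x

  comparable? : ∀ x y → Dec (Comparable x y)
  comparable? x y = ≼-dec x y ⊎-dec ≼-dec y x

  ¬comparable⇒incomparable : ∀ {x y} → ¬ Comparable x y → Incomparable x y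
  ¬comparable⇒incomparable ¬c = ¬c ∘ inj₁ , ¬c ∘ inj₂

  ≡⇒≼ : ∀ {x y} → x ≡ y → x ≼ y
  ≡⇒≼ refl = ≼-refl _

  incomparable-sym : ∀ {x y} → Incomparable x y → Incomparable y x
  incomparable-sym = swap

  incomparable⇒≢ : ∀ {x y} → Incomparable x y → x ≢ y
  incomparable⇒≢ (x⋠y , _) = x⋠y ∘ ≡⇒≼

  incomparable-above : ∀ {p q w} → Incomparable p q → w ≢ p → w ≢ q → w ≼ p × w ≼ q
  incomparable-above {p} {q} {w} inc@(p⋠q , q⋠p) w≢p w≢q
    with almostLinear p q w (incomparable⇒≢ inc , w≢q ∘ sym , w≢p ∘ sym)
  ... | inj₁ (p≼q , _)        = ⊥-elim (p⋠q p≼q)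
  ... | inj₂ (inj₁ (q≼p , _)) = ⊥-elim (q⋠p q≼p)
  ... | inj₂ (inj₂ w≼p×w≼q)   = w≼p×w≼q

  incomparable-maximal : ∀ {p q y} → Incomparable p q → p ≼ y → y ≡ p
  incomparable-maximal {p} {q} {y} inc p≼y with y ≟ p | y ≟ q
  ... | yes y≡p | _       = y≡p
  ... | no _    | yes refl = ⊥-elim (proj₁ inc p≼y)
  ... | no y≢p  | no y≢q  = ≼-antisym (proj₁ (incomparable-above inc y≢p y≢q)) p≼y

  -- Every element outside {p, q} lies below p, hence cannot be maximal.
  incomparable-unique : ∀ {p q x y} → Incomparable p q → Incomparable x y → x ≡ p ⊎ x ≡ q
  incomparable-unique {p} {q} {x} inc inc′ with x ≟ p | x ≟ q
  ... | yes x≡p | _       = inj₁ x≡p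
  ... | no _    | yes x≡q = inj₂ x≡q
  ... | no x≢p  | no x≢q  =
    ⊥-elim (x≢p (sym (incomparable-maximal inc′ (proj₁ (incomparable-above inc x≢p x≢q)))))

  linear⊎incomparable : Linear X ⊎ ∃₂ Incomparable
  linear⊎incomparable with all? (λ x → all? (comparable? x))
  ... | yes linear = inj₁ linear
  ... | no ¬linear with ¬∀⟶∃¬ _ _ (λ x → all? (comparable? x)) ¬linear
  ...   | x , ¬∀y with ¬∀⟶∃¬ _ _ (comparable? x) ¬∀y
  ...     | y , ¬c = inj₂ (x , y , ¬comparable⇒incomparable ¬c)

module _ {X Y : ALO} (h : Hom X Y) where
  open IsHom (isHom h)

  hom-reflects-incomparable : ∀ {x y} → Incomparable Y (fun h x) (fun h y) → Incomparable X x y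
  hom-reflects-incomparable (hx⋠hy , hy⋠hx) = hx⋠hy ∘ mono , hy⋠hx ∘ mono

  hom-collapses-reversed : ∀ {x y} → ALO._≼_ X y x → ALO._≼_ Y (fun h x) (fun h y) → x ≡ y
  hom-collapses-reversed y≼x hx≼hy = inj (ALO.≼-antisym Y hx≼hy (mono y≼x))

  hom-reflects-≼-from-linear : Linear X → ∀ {x y} → ALO._≼_ Y (fun h x) (fun h y) → ALO._≼_ X x y
  hom-reflects-≼-from-linear linear {x} {y} hx≼hy with linear x y
  ... | inj₁ x≼y = x≼y
  ... | inj₂ y≼x = ≡⇒≼ X (hom-collapses-reversed y≼x hx≼hy)

  -- If x, y were incomparable, z would lie below x, forcing h z = h x.
  hom-reflects-≼-below-third : ∀ {x y z} → z ≢ x → z ≢ y →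
    ALO._≼_ Y (fun h x) (fun h y) → ALO._≼_ Y (fun h x) (fun h z) → ALO._≼_ X x y
  hom-reflects-≼-below-third {x} {y} {z} z≢x z≢y hx≼hy hx≼hz
    with ALO.≼-dec X x y | ALO.≼-dec X y x
  ... | yes x≼y | _       = x≼y
  ... | no _    | yes y≼x = ≡⇒≼ X (hom-collapses-reversed y≼x hx≼hy)
  ... | no x⋠y  | no y⋠x  =
    ⊥-elim (z≢x (sym (hom-collapses-reversed (proj₁ (incomparable-above X (x⋠y , y⋠x) z≢x z≢y)) hx≼hz)))

FinLO-full : (X Y : ALO) → Linear X → (f : Fin (size X) → Fin (size Y)) → IsHom X Y f ⇔ IsOrderEmbedding X Y f
FinLO-full X Y linX f = mk⇔ hom⇒embedding embedding⇒hom
  where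
  hom⇒embedding : IsHom X Y f → IsOrderEmbedding X Y f
  hom⇒embedding h = IsHom.inj h , λ _ _ → mk⇔ (IsHom.mono h) (hom-reflects-≼-from-linear (hom f h) linX)
  embedding⇒hom : IsOrderEmbedding X Y f → IsHom X Y f
  embedding⇒hom (inj , ≼⇔≼) = record { inj = inj ; mono = Equivalence.to (≼⇔≼ _ _) }

-- Linear extensions

HasMinimum : {A : Set} → (A → A → Set) → A → A → A → Set
HasMinimum _≤_ x y z = (x ≤ y × x ≤ z) ⊎ (y ≤ x × y ≤ z) ⊎ (z ≤ x × z ≤ y)

HasMinimum-map : {A B : Set} {_≤_ : A → A → Set} {_≤′_ : B → B → Set} (f : A → B) →
  (∀ {x y} → x ≤ y → f x ≤′ f y) → ∀ {x y z} → HasMinimum _≤_ x y z → HasMinimum _≤′_ (f x) (f y) (f z)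
HasMinimum-map f mono = Sum.map (Product.map mono mono) (Sum.map (Product.map mono mono) (Product.map mono mono))

total⇒hasMinimum : {A : Set} {_≤_ : A → A → Set} → Total _≤_ → Transitive _≤_ → ∀ x y z → HasMinimum _≤_ x y z
total⇒hasMinimum total ≤-trans′ x y z with total x y | total x z | total y z
... | inj₁ x≤y | inj₁ x≤z | _        = inj₁ (x≤y , x≤z)
... | inj₁ x≤y | inj₂ z≤x | _        = inj₂ (inj₂ (z≤x , ≤-trans′ z≤x x≤y))
... | inj₂ y≤x | _        | inj₁ y≤z = inj₂ (inj₁ (y≤x , y≤z))
... | inj₂ y≤x | _        | inj₂ z≤y = inj₂ (inj₂ (≤-trans′ z≤y y≤x , z≤y))

total⇒almostLinear : (P : FinPoset) → Total (FinPoset._≼_ P) → AlmostLinear P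
total⇒almostLinear P total x y z _ = total⇒hasMinimum total (FinPoset.≼-trans P) x y z

-- Placing p below q is the only choice needed, since {p, q} is the unique incomparable pair.
module Linearization (X : ALO) {p q} (inc : Incomparable X p q) where
  open ALO X hiding (size)

  _⊑_ : Fin (size X) → Fin (size X) → Set
  x ⊑ y = x ≼ y ⊎ (x ≡ p × y ≡ q)

  ⊑-antisym : ∀ {x y} → x ⊑ y → y ⊑ x → x ≡ y
  ⊑-antisym (inj₁ x≼y)           (inj₁ y≼x)        = ≼-antisym x≼y y≼x
  ⊑-antisym (inj₁ q≼p)           (inj₂ (refl , refl)) = ⊥-elim (proj₂ inc q≼p)
  ⊑-antisym (inj₂ (refl , refl)) (inj₁ q≼p)        = ⊥-elim (proj₂ inc q≼p)
  ⊑-antisym (inj₂ (refl , refl)) (inj₂ (q≡p , _))  = ⊥-elim (incomparable⇒≢ X inc (sym q≡p))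

  ⊑-trans : ∀ {x y z} → x ⊑ y → y ⊑ z → x ⊑ z
  ⊑-trans (inj₁ x≼y) (inj₁ y≼z) = inj₁ (≼-trans x≼y y≼z)
  ⊑-trans {x} (inj₁ x≼p) (inj₂ (refl , refl)) with x ≟ p | x ≟ q
  ... | yes x≡p | _       = inj₂ (x≡p , refl)
  ... | no _    | yes refl = ⊥-elim (proj₂ inc x≼p)
  ... | no x≢p  | no x≢q  = inj₁ (proj₂ (incomparable-above X inc x≢p x≢q))
  ⊑-trans (inj₂ (refl , refl)) (inj₁ q≼z) = inj₂ (refl , incomparable-maximal X (incomparable-sym X inc) q≼z)
  ⊑-trans (inj₂ (refl , refl)) (inj₂ (q≡p , _)) = ⊥-elim (incomparable⇒≢ X inc (sym q≡p))

  ⊑-total : Total _⊑_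
  ⊑-total x y with comparable? X x y
  ... | yes x~y = Sum.map inj₁ inj₁ x~y
  ... | no ¬x~y with incomparable-unique X inc inc′ | incomparable-unique X inc (incomparable-sym X inc′)
    where inc′ = ¬comparable⇒incomparable X ¬x~y
  ...   | inj₁ x≡p | inj₂ y≡q = inj₁ (inj₂ (x≡p , y≡q))
  ...   | inj₂ x≡q | inj₁ y≡p = inj₂ (inj₂ (y≡p , x≡q))
  ...   | inj₁ refl | inj₁ refl = ⊥-elim (¬x~y (inj₁ (≼-refl _)))
  ...   | inj₂ refl | inj₂ refl = ⊥-elim (¬x~y (inj₁ (≼-refl _)))

  poset′ : FinPoset
  poset′ = record
    { size = size X ; _≼_ = _⊑_
    ; ≼-dec = λ x y → ≼-dec x y ⊎-dec (x ≟ p ×-dec y ≟ q)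
    ; ≼-refl = λ x → inj₁ (≼-refl x)
    ; ≼-antisym = ⊑-antisym ; ≼-trans = ⊑-trans }

  linearization : ALO
  linearization = record { poset = poset′ ; almostLinear = total⇒almostLinear poset′ ⊑-total }

  linearization-linear : Linear linearization
  linearization-linear = ⊑-total

  linearization-embed : Hom X linearization
  linearization-embed = hom id (record { inj = id ; mono = inj₁ })

  p⊑q : p ⊑ q
  p⊑q = inj₂ (refl , refl)

linearExtension : (X : ALO) → Σ ALO λ Y → Linear Y × Hom X Y
linearExtension X with linear⊎incomparable X
... | inj₁ linear = X , linear , idH X
... | inj₂ (_ , _ , inc) = linearization , linearization-linear , linearization-embed
  where open Linearization X inc

-- L + B and the ternary structure of an almost linear order

splitAt-injective : ∀ m {n} {x y : Fin (m + n)} → splitAt m x ≡ splitAt m y → x ≡ y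
splitAt-injective m {n} {x} {y} eq =
  trans (sym (join-splitAt m n x)) (trans (cong (join m n) eq) (join-splitAt m n y))

_⊕_ : FinPoset → FinPoset → FinPoset
P ⊕ Q = record
  { size = m + size Q
  ; _≼_ = λ x y → (P._≼_ ⊎-< Q._≼_) (splitAt m x) (splitAt m y)
  ; ≼-dec = λ x y → ⊎-<-decidable P.≼-dec Q.≼-dec (splitAt m x) (splitAt m y)
  ; ≼-refl = λ x → ⊎-<-refl (P.≼-refl _) (Q.≼-refl _)
  ; ≼-antisym = λ x≼y y≼x → splitAt-injective m (Pointwise-≡⇒≡ (⊎-<-antisymmetric P.≼-antisym Q.≼-antisym x≼y y≼x))
  ; ≼-trans = ⊎-<-transitive P.≼-trans Q.≼-trans }
  where
  module P = FinPoset P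
  module Q = FinPoset Q
  open FinPoset using (size)
  m = size P

module _ (P Q : FinPoset) where
  open FinPoset

  ⊕-inl-mono : ∀ {a b} → _≼_ P a b → _≼_ (P ⊕ Q) (a ↑ˡ size Q) (b ↑ˡ size Q)
  ⊕-inl-mono {a} {b} a≼b =
    subst₂ (_⊎-<_ (_≼_ P) (_≼_ Q)) (sym (splitAt-↑ˡ _ a _)) (sym (splitAt-↑ˡ _ b _)) (₁∼₁ a≼b)

  ⊕-inr-reflects : ∀ {i j} → _≼_ (P ⊕ Q) (size P ↑ʳ i) (size P ↑ʳ j) → _≼_ Q i j
  ⊕-inr-reflects {i} {j} r = drop-inj₂ (subst₂ (_⊎-<_ (_≼_ P) (_≼_ Q)) (splitAt-↑ʳ _ _ i) (splitAt-↑ʳ _ _ j) r)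

  -- The minimum of three elements is the least of those lying in P, if any.
  ⊕-almostLinear : Total (_≼_ P) → AlmostLinear Q → AlmostLinear (P ⊕ Q)
  ⊕-almostLinear total almostLinear x y z (x≢y , y≢z , x≢z) =
    minimum (splitAt (size P) x) (splitAt (size P) y) (splitAt (size P) z)
      (x≢y ∘ splitAt-injective _) (y≢z ∘ splitAt-injective _) (x≢z ∘ splitAt-injective _)
    where
    _⊴_ = _⊎-<_ (_≼_ P) (_≼_ Q)
    minimum : ∀ u v w → u ≢ v → v ≢ w → u ≢ w → HasMinimum _⊴_ u v w
    minimum (inj₁ a) (inj₁ b) (inj₁ c) _ _ _ =
      HasMinimum-map {_≤_ = _≼_ P} {_≤′_ = _⊴_} inj₁ ₁∼₁ (total⇒hasMinimum total (≼-trans P) a b c)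
    minimum (inj₁ a) (inj₁ b) (inj₂ c) _ _ _ = Sum.map (λ a≼b → ₁∼₁ a≼b , ₁∼₂) (λ b≼a → inj₁ (₁∼₁ b≼a , ₁∼₂)) (total a b)
    minimum (inj₁ a) (inj₂ b) (inj₁ c) _ _ _ = Sum.map (λ a≼c → ₁∼₂ , ₁∼₁ a≼c) (λ c≼a → inj₂ (₁∼₁ c≼a , ₁∼₂)) (total a c)
    minimum (inj₁ a) (inj₂ b) (inj₂ c) _ _ _ = inj₁ (₁∼₂ , ₁∼₂)
    minimum (inj₂ a) (inj₁ b) (inj₁ c) _ _ _ = inj₂ (Sum.map (λ b≼c → ₁∼₂ , ₁∼₁ b≼c) (λ c≼b → ₁∼₂ , ₁∼₁ c≼b) (total b c))
    minimum (inj₂ a) (inj₁ b) (inj₂ c) _ _ _ = inj₂ (inj₁ (₁∼₂ , ₁∼₂))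
    minimum (inj₂ a) (inj₂ b) (inj₁ c) _ _ _ = inj₂ (inj₂ (₁∼₂ , ₁∼₂))
    minimum (inj₂ a) (inj₂ b) (inj₂ c) u≢v v≢w u≢w =
      HasMinimum-map {_≤_ = _≼_ Q} {_≤′_ = _⊴_} inj₂ ₂∼₂
        (almostLinear a b c (u≢v ∘ cong inj₂ , v≢w ∘ cong inj₂ , u≢w ∘ cong inj₂))

antichain₂ : FinPoset
antichain₂ = record
  { size = 2 ; _≼_ = _≡_ ; ≼-dec = _≟_ ; ≼-refl = λ _ → refl
  ; ≼-antisym = λ x≡y _ → x≡y ; ≼-trans = trans }

antichain₂-almostLinear : AlmostLinear antichain₂
antichain₂-almostLinear zero          zero          _             (x≢y , _)       = ⊥-elim (x≢y refl)
antichain₂-almostLinear (suc zero)    (suc zero)    _             (x≢y , _)       = ⊥-elim (x≢y refl)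
antichain₂-almostLinear zero          (suc zero)    zero          (_ , _ , x≢z)   = ⊥-elim (x≢z refl)
antichain₂-almostLinear zero          (suc zero)    (suc zero)    (_ , y≢z , _)   = ⊥-elim (y≢z refl)
antichain₂-almostLinear (suc zero)    zero          zero          (_ , y≢z , _)   = ⊥-elim (y≢z refl)
antichain₂-almostLinear (suc zero)    zero          (suc zero)    (_ , _ , x≢z)   = ⊥-elim (x≢z refl)

module _ (L : ALO) (linear : Linear L) where
  private
    P = ALO.poset L

  plusB : ALO
  plusB = record { poset = P ⊕ antichain₂ ; almostLinear = ⊕-almostLinear P antichain₂ linear antichain₂-almostLinear }

  plusB-inl : Hom L plusB
  plusB-inl = hom (_↑ˡ 2) (record { inj = ↑ˡ-injective 2 _ _ ; mono = ⊕-inl-mono P antichain₂ })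

  plusB-tops-incomparable : Incomparable plusB (size L ↑ʳ zero) (size L ↑ʳ suc zero)
  plusB-tops-incomparable =
    (λ r → 0≢1 (⊕-inr-reflects P antichain₂ r)) , (λ r → 0≢1 (sym (⊕-inr-reflects P antichain₂ r)))
    where
    0≢1 : zero ≢ suc zero
    0≢1 ()

module _ (X : ALO) where
  open ALO X hiding (size)

  BelowBoth : Fin (size X) → Fin (size X) → Fin (size X) → Set
  BelowBoth x y z = Distinct3 x y z × x ≼ y × x ≼ z

  private
    ≼-≢-step : ∀ {x y z} → x ≼ y → x ≢ y → y ≼ z → x ≢ z
    ≼-≢-step x≼y x≢y y≼z refl = x≢y (≼-antisym x≼y y≼z)

    belowBoth-swap : ∀ {x y z} → BelowBoth x y z → BelowBoth x z y
    belowBoth-swap ((x≢y , y≢z , x≢z) , x≼y , x≼z) = (x≢z , y≢z ∘ sym , x≢y) , x≼z , x≼y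

    belowBoth-trans : ∀ {x y z w w′} → BelowBoth x y w → BelowBoth y z w′ → BelowBoth x z w′
    belowBoth-trans ((x≢y , _ , _) , x≼y , _) ((_ , z≢w′ , _) , y≼z , y≼w′) =
      (≼-≢-step x≼y x≢y y≼z , z≢w′ , ≼-≢-step x≼y x≢y y≼w′) , ≼-trans x≼y y≼z , ≼-trans x≼y y≼w′

    belowBoth-total : ∀ x y z → Distinct3 x y z → BelowBoth x y z ⊎ BelowBoth y z x ⊎ BelowBoth z x y
    belowBoth-total x y z d@(x≢y , y≢z , x≢z) with almostLinear x y z d
    ... | inj₁ (x≼y , x≼z)        = inj₁ (d , x≼y , x≼z)
    ... | inj₂ (inj₁ (y≼x , y≼z)) = inj₂ (inj₁ ((y≢z , x≢z ∘ sym , x≢y ∘ sym) , y≼z , y≼x))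
    ... | inj₂ (inj₂ (z≼x , z≼y)) = inj₂ (inj₂ ((x≢z ∘ sym , x≢y , y≢z ∘ sym) , z≼x , z≼y))

  toTStr : TStr
  toTStr = record
    { size = size X ; R = BelowBoth
    ; R-dec = λ x y z → ((¬? (x ≟ y) ×-dec ¬? (y ≟ z) ×-dec ¬? (x ≟ z)) ×-dec ≼-dec x y ×-dec ≼-dec x z)
    ; R-distinct = proj₁
    ; R-swap = λ _ _ _ → mk⇔ belowBoth-swap belowBoth-swap
    ; R-trans = belowBoth-trans
    ; R-total = belowBoth-total }

  toTStr-iso : ∀ {p q} → Incomparable X p q → Iso X (toALO toTStr)
  toTStr-iso {p} {q} inc =
    hom id (record { inj = id ; mono = mono }) , hom id (record { inj = id ; mono = comono }) , (λ _ → refl) , (λ _ → refl)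
    where
    below-tops : ∀ {x y} → x ≼ y → x ≢ y → (x ≼ p × x ≼ q) × x ≢ p × x ≢ q
    below-tops {x} x≼y x≢y = incomparable-above X inc x≢p x≢q , x≢p , x≢q
      where
      x≢p : x ≢ p
      x≢p refl = x≢y (sym (incomparable-maximal X inc x≼y))
      x≢q : x ≢ q
      x≢q refl = x≢y (sym (incomparable-maximal X (incomparable-sym X inc) x≼y))

    -- The witness for x < y is whichever of the maximal elements p, q differs from y.
    mono : ∀ {x y} → x ≼ y → ALO._≼_ (toALO toTStr) x y
    mono {x} {y} x≼y with x ≟ y
    ... | yes x≡y = inj₁ x≡y
    ... | no x≢y with below-tops x≼y x≢y | y ≟ p
    ...   | (_ , x≼q) , _ , x≢q | yes refl = inj₂ (q , (x≢y , incomparable⇒≢ X inc , x≢q) , x≼y , x≼q)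
    ...   | (x≼p , _) , x≢p , _ | no y≢p   = inj₂ (p , (x≢y , y≢p , x≢p) , x≼y , x≼p)

    comono : ∀ {x y} → ALO._≼_ (toALO toTStr) x y → x ≼ y
    comono (inj₁ refl) = ≼-refl _
    comono (inj₂ (_ , _ , x≼y , _)) = x≼y

linear⊎inFintLO : (X : ALO) → Linear X ⊎ InFintLO X
linear⊎inFintLO X = Sum.map id (λ (_ , _ , inc) → toTStr X , toTStr-iso X inc) (linear⊎incomparable X)

linear-into-FintLO : (L : ALO) → Linear L → Σ TStr λ S → Hom L (toALO S)
linear-into-FintLO L linear =
  toTStr (plusB L linear) , proj₁ (toTStr-iso (plusB L linear) (plusB-tops-incomparable L linear)) ∘H plusB-inl L linear

placeBelow : (X : ALO) {p q : Fin (size X)} → Incomparable X p q →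
  Σ TStr λ S → Σ (Hom X (toALO S)) λ u → ALO._≼_ (toALO S) (fun u p) (fun u q)
placeBelow X inc = S , v ∘H linearization-embed , IsHom.mono (isHom v) p⊑q
  where
  open Linearization X inc
  S = proj₁ (linear-into-FintLO linearization linearization-linear)
  v = proj₂ (linear-into-FintLO linearization linearization-linear)

FintLO-cofinal : (X : ALO) → Σ TStr λ S → Hom X (toALO S)
FintLO-cofinal X with linearExtension X
... | Y , linear , u with linear-into-FintLO Y linear
...   | S , v = S , v ∘H u

-- Fullness of FintLO

module _ (S : TStr) where
  open TStr S renaming (size to n)

  _<R_ : Fin n → Fin n → Set
  x <R y = ∃ λ w → R x y w

  <R⇒≢ : ∀ {x y} → x <R y → x ≢ y
  <R⇒≢ (_ , r) = proj₁ (R-distinct r)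

  ≼-strict : ∀ {x y} → ALO._≼_ (toALO S) x y → x ≢ y → x <R y
  ≼-strict (inj₁ x≡y) x≢y = ⊥-elim (x≢y x≡y)
  ≼-strict (inj₂ x<y) _   = x<y

  R⇔<R×<R : ∀ {x y z} → Distinct3 x y z → R x y z ⇔ (x <R y × x <R z)
  R⇔<R×<R {x} {y} {z} d = mk⇔ (λ r → (z , r) , (y , Equivalence.to (R-swap x y z) r)) from
    where
    from : x <R y × x <R z → R x y z
    from ((w , rxyw) , (w′ , rxzw′)) with R-total x y z d
    ... | inj₁ rxyz        = rxyz
    ... | inj₂ (inj₁ ryzx) = ⊥-elim (proj₁ (R-distinct (R-trans (Equivalence.to (R-swap y z x) ryzx) rxyw)) refl)
    ... | inj₂ (inj₂ rzxy) = ⊥-elim (proj₁ (R-distinct (R-trans rzxy rxzw′)) refl)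

FintLO-full : (S T : TStr) (f : Fin (TStr.size S) → Fin (TStr.size T)) →
  IsEmb S T f ⇔ IsHom (toALO S) (toALO T) f
FintLO-full S T f = mk⇔ emb⇒hom hom⇒emb
  where
  emb⇒hom : IsEmb S T f → IsHom (toALO S) (toALO T) f
  emb⇒hom e = record { inj = IsEmb.inj e ; mono = mono }
    where
    mono : ∀ {a b} → ALO._≼_ (toALO S) a b → ALO._≼_ (toALO T) (f a) (f b)
    mono (inj₁ a≡b)      = inj₁ (cong f a≡b)
    mono (inj₂ (w , r)) = inj₂ (f w , Equivalence.to (IsEmb.pres e _ _ _) r)

  hom⇒emb : IsHom (toALO S) (toALO T) f → IsEmb S T f
  hom⇒emb h = record { inj = inj ; pres = λ x y z → mk⇔ preserve (reflect x y z) }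
    where
    open IsHom h
    preserve-< : ∀ {x y} → _<R_ S x y → _<R_ T (f x) (f y)
    preserve-< x<y = ≼-strict T (mono (inj₂ x<y)) (<R⇒≢ S x<y ∘ inj)
    preserve : ∀ {x y z} → TStr.R S x y z → TStr.R T (f x) (f y) (f z)
    preserve {x} {y} {z} r with TStr.R-distinct S r
    ... | x≢y , y≢z , x≢z = Equivalence.from (R⇔<R×<R T (x≢y ∘ inj , y≢z ∘ inj , x≢z ∘ inj))
            (preserve-< (z , r) , preserve-< (y , Equivalence.to (TStr.R-swap S x y z) r))
    reflect-< : ∀ {x y z} → x ≢ y → z ≢ x → z ≢ y → _<R_ T (f x) (f y) → _<R_ T (f x) (f z) → _<R_ S x y
    reflect-< x≢y z≢x z≢y fx<fy fx<fz =
      ≼-strict S (hom-reflects-≼-below-third (hom f h) z≢x z≢y (inj₂ fx<fy) (inj₂ fx<fz)) x≢y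
    reflect : ∀ x y z → TStr.R T (f x) (f y) (f z) → TStr.R S x y z
    reflect x y z r with TStr.R-distinct T r
    ... | fx≢fy , fy≢fz , fx≢fz = Equivalence.from (R⇔<R×<R S (x≢y , y≢z , x≢z))
            (reflect-< x≢y (x≢z ∘ sym) (y≢z ∘ sym) fx<fy fx<fz , reflect-< x≢z (x≢y ∘ sym) y≢z fx<fz fx<fy)
      where
      x≢y = fx≢fy ∘ cong f
      y≢z = fy≢fz ∘ cong f
      x≢z = fx≢fz ∘ cong f
      fx<fy = f z , r
      fx<fz = f y , Equivalence.to (TStr.R-swap T _ _ _) r

toHom : ∀ {S T} → Emb S T → Hom (toALO S) (toALO T)
toHom {S} {T} e = hom (efun e) (Equivalence.to (FintLO-full S T (efun e)) (isEmb e))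

toEmb : ∀ {S T} → Hom (toALO S) (toALO T) → Emb S T
toEmb {S} {T} h = emb (fun h) (Equivalence.from (FintLO-full S T (fun h)) (isHom h))

-- Amalgamating linear orders

module _ {n} {P : Fin n → Set} (P? : ∀ i → Dec (P i)) where

  satisfying : Subset n
  satisfying = tabulate (λ i → isYes (P? i))

  ∈-satisfying : ∀ {i} → i ∈ satisfying ⇔ P i
  ∈-satisfying {i} = mk⇔
    (λ i∈ → toWitness {a? = P? i} (Equivalence.from T-≡ (trans (sym (lookup∘tabulate _ i)) ([]=⇒lookup i∈))))
    (λ Pi → lookup⇒[]= i _ (trans (lookup∘tabulate _ i) (Equivalence.to T-≡ (fromWitness {a? = P? i} Pi))))

satisfying-⊆ : ∀ {n} {P Q : Fin n → Set} (P? : ∀ i → Dec (P i)) (Q? : ∀ i → Dec (Q i)) →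
  (∀ {i} → P i → Q i) → satisfying P? ⊆ satisfying Q?
satisfying-⊆ P? Q? P⇒Q = Equivalence.from (∈-satisfying Q?) ∘ P⇒Q ∘ Equivalence.to (∈-satisfying P?)

module _ {X Y : ALO} (h : Hom X Y) where
  open ALO Y hiding (size)

  preimage-below : Fin (size Y) → Subset (size X)
  preimage-below y = satisfying (λ x → ≼-dec (fun h x) y)

  rank : Fin (size Y) → ℕ
  rank y = ∣ preimage-below y ∣

  preimage-below-mono : ∀ {y y′} → y ≼ y′ → preimage-below y ⊆ preimage-below y′
  preimage-below-mono y≼y′ = satisfying-⊆ _ _ (λ hx≼y → ≼-trans hx≼y y≼y′)

  rank-mono : ∀ {y y′} → y ≼ y′ → rank y ≤ rank y′
  rank-mono = p⊆q⇒∣p∣≤∣q∣ ∘ preimage-below-mono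

  rank-strict : ∀ {y y′ x} → y ≼ y′ → fun h x ≼ y′ → ¬ fun h x ≼ y → rank y < rank y′
  rank-strict y≼y′ hx≼y′ hx⋠y = p⊂q⇒∣p∣<∣q∣
    (preimage-below-mono y≼y′ , _ , Equivalence.from (∈-satisfying _) hx≼y′ , hx⋠y ∘ Equivalence.to (∈-satisfying _))

  rank-reflects : Linear Y → ∀ {y y′} → rank y < rank y′ → y ≼ y′
  rank-reflects linear {y} {y′} r with linear y y′
  ... | inj₁ y≼y′ = y≼y′
  ... | inj₂ y′≼y = ⊥-elim (<⇒≱ r (rank-mono y′≼y))

  rank-image : Linear X → ∀ x → rank (fun h x) ≡ ∣ satisfying (λ x′ → ALO.≼-dec X x′ x) ∣
  rank-image linear x = ≤-antisym
    (p⊆q⇒∣p∣≤∣q∣ (satisfying-⊆ mapped-below? below? (hom-reflects-≼-from-linear h linear)))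
    (p⊆q⇒∣p∣≤∣q∣ (satisfying-⊆ below? mapped-below? (IsHom.mono (isHom h))))
    where
    below? = λ x′ → ALO.≼-dec X x′ x
    mapped-below? = λ x′ → ≼-dec (fun h x′) (fun h x)

-- W is A ⊎ B, ordered within A and within B as given, and across by rank, ties resolved in favour of A;
-- g′ then sends g x to f x, which has the same rank as g x.
module LinearAmalgam {X A B : ALO} (linX : Linear X) (linA : Linear A) (linB : Linear B)
                     (f : Hom X A) (g : Hom X B) where
  private
    nA = size A
    nB = size B
    module A = ALO A
    module B = ALO B

  _⊑_ : Fin nA ⊎ Fin nB → Fin nA ⊎ Fin nB → Set
  inj₁ a ⊑ inj₁ a′ = a A.≼ a′
  inj₁ a ⊑ inj₂ b  = rank f a ≤ rank g b
  inj₂ b ⊑ inj₁ a  = rank g b < rank f a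
  inj₂ b ⊑ inj₂ b′ = b B.≼ b′

  ⊑-dec : ∀ u v → Dec (u ⊑ v)
  ⊑-dec (inj₁ a) (inj₁ a′) = A.≼-dec a a′
  ⊑-dec (inj₁ a) (inj₂ b)  = rank f a ≤? rank g b
  ⊑-dec (inj₂ b) (inj₁ a)  = rank g b <? rank f a
  ⊑-dec (inj₂ b) (inj₂ b′) = B.≼-dec b b′

  ⊑-refl : ∀ u → u ⊑ u
  ⊑-refl (inj₁ a) = A.≼-refl a
  ⊑-refl (inj₂ b) = B.≼-refl b

  ⊑-antisym : ∀ {u v} → u ⊑ v → v ⊑ u → u ≡ v
  ⊑-antisym {inj₁ _} {inj₁ _} a≼a′ a′≼a = cong inj₁ (A.≼-antisym a≼a′ a′≼a)
  ⊑-antisym {inj₁ _} {inj₂ _} r s = ⊥-elim (<⇒≱ s r)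
  ⊑-antisym {inj₂ _} {inj₁ _} r s = ⊥-elim (<⇒≱ r s)
  ⊑-antisym {inj₂ _} {inj₂ _} b≼b′ b′≼b = cong inj₂ (B.≼-antisym b≼b′ b′≼b)

  ⊑-trans : ∀ {u v w} → u ⊑ v → v ⊑ w → u ⊑ w
  ⊑-trans {inj₁ _} {inj₁ _} {inj₁ _} r s = A.≼-trans r s
  ⊑-trans {inj₁ _} {inj₁ _} {inj₂ _} r s = ≤-trans (rank-mono f r) s
  ⊑-trans {inj₁ _} {inj₂ _} {inj₁ _} r s = rank-reflects f linA (≤-<-trans r s)
  ⊑-trans {inj₁ _} {inj₂ _} {inj₂ _} r s = ≤-trans r (rank-mono g s)
  ⊑-trans {inj₂ _} {inj₁ _} {inj₁ _} r s = <-≤-trans r (rank-mono f s)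
  ⊑-trans {inj₂ _} {inj₁ _} {inj₂ _} r s = rank-reflects g linB (<-≤-trans r s)
  ⊑-trans {inj₂ _} {inj₂ _} {inj₁ _} r s = ≤-<-trans (rank-mono g r) s
  ⊑-trans {inj₂ _} {inj₂ _} {inj₂ _} r s = B.≼-trans r s

  ⊑-total : Total _⊑_
  ⊑-total (inj₁ a) (inj₁ a′) = linA a a′
  ⊑-total (inj₂ b) (inj₂ b′) = linB b b′
  ⊑-total (inj₁ a) (inj₂ b) with rank f a ≤? rank g b
  ... | yes r = inj₁ r
  ... | no r  = inj₂ (≰⇒> r)
  ⊑-total (inj₂ b) (inj₁ a) with rank f a ≤? rank g b
  ... | yes r = inj₂ r
  ... | no r  = inj₁ (≰⇒> r)

  posetW : FinPoset
  posetW = record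
    { size = nA + nB ; _≼_ = λ x y → splitAt nA x ⊑ splitAt nA y
    ; ≼-dec = λ x y → ⊑-dec (splitAt nA x) (splitAt nA y)
    ; ≼-refl = λ x → ⊑-refl (splitAt nA x)
    ; ≼-antisym = λ r s → splitAt-injective nA (⊑-antisym r s)
    ; ≼-trans = λ {x} {y} {z} → ⊑-trans {splitAt nA x} {splitAt nA y} {splitAt nA z} }

  W : ALO
  W = record
    { poset = posetW ; almostLinear = total⇒almostLinear posetW (λ x y → ⊑-total (splitAt nA x) (splitAt nA y)) }

  into-W : {K : ALO} (ψ : Fin (size K) → Fin nA ⊎ Fin nB) → (∀ {k k′} → ψ k ≡ ψ k′ → k ≡ k′) →
    (∀ {k k′} → ALO._≼_ K k k′ → ψ k ⊑ ψ k′) → Hom K W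
  into-W ψ inj mono = hom (join nA nB ∘ ψ) (record
    { inj = λ {k} {k′} e →
        inj (trans (sym (splitAt-join nA nB (ψ k))) (trans (cong (splitAt nA) e) (splitAt-join nA nB (ψ k′))))
    ; mono = λ {k} {k′} r →
        subst₂ _⊑_ (sym (splitAt-join nA nB (ψ k))) (sym (splitAt-join nA nB (ψ k′))) (mono r) })

  f′ : Hom A W
  f′ = into-W inj₁ inj₁-injective id

  InImage : Fin nB → Set
  InImage b = ∃ λ x → fun g x ≡ b

  glue : (b : Fin nB) → Dec (InImage b) → Fin nA ⊎ Fin nB
  glue b (yes (x , _)) = inj₁ (fun f x)
  glue b (no _)        = inj₂ b

  inImage? : ∀ b → Dec (InImage b)
  inImage? b = any? (λ x → fun g x ≟ b)

  rank-f≡rank-g : ∀ x → rank f (fun f x) ≡ rank g (fun g x)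
  rank-f≡rank-g x = trans (rank-image f linX x) (sym (rank-image g linX x))

  glue-mono : ∀ {b b′} → b B.≼ b′ → ∀ d d′ → glue b d ⊑ glue b′ d′
  glue-mono b≼b′ (yes (x , refl)) (yes (x′ , refl)) = IsHom.mono (isHom f) (hom-reflects-≼-from-linear g linX b≼b′)
  glue-mono b≼b′ (yes (x , refl)) (no _) = subst (_≤ _) (sym (rank-f≡rank-g x)) (rank-mono g b≼b′)
  glue-mono b≼b′ (no b∉) (yes (x , refl)) = subst (_ <_) (sym (rank-f≡rank-g x))
    (rank-strict g b≼b′ (B.≼-refl _) (λ gx≼b → b∉ (x , B.≼-antisym gx≼b b≼b′)))
  glue-mono b≼b′ (no _) (no _) = b≼b′

  glue-injective : ∀ {b b′} d d′ → glue b d ≡ glue b′ d′ → b ≡ b′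
  glue-injective (yes (x , refl)) (yes (x′ , refl)) e = cong (fun g) (IsHom.inj (isHom f) (inj₁-injective e))
  glue-injective (no _) (no _) e = inj₂-injective e

  g′ : Hom B W
  g′ = into-W (λ b → glue b (inImage? b)) (λ {b} {b′} → glue-injective (inImage? b) (inImage? b′))
              (λ {b} {b′} b≼b′ → glue-mono b≼b′ (inImage? b) (inImage? b′))

  commutes : ∀ x → fun f′ (fun f x) ≡ fun g′ (fun g x)
  commutes x with inImage? (fun g x)
  ... | yes (x′ , gx′≡gx) = cong (λ k → fun f k ↑ˡ nB) (IsHom.inj (isHom g) (sym gx′≡gx))
  ... | no gx∉ = ⊥-elim (gx∉ (x , refl))

linear-amalgamable : (X : ALO) → Linear X → AmalgamableObj X
linear-amalgamable X linX {A} {B} f g with linearExtension A | linearExtension B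
... | A′ , linA′ , a | B′ , linB′ , b = W , f′ ∘H a , g′ ∘H b , commutes
  where open LinearAmalgam linX linA′ linB′ (a ∘H f) (b ∘H g)

-- Arrows whose image is a chain

ChainImage : ∀ {Z Z′} → Hom Z Z′ → Set
ChainImage {Z′ = Z′} e = ∀ p q → Comparable Z′ (fun e p) (fun e q)

chainImage⇒factorsThroughLinear : ∀ {Z Z′} (e : Hom Z Z′) → ChainImage e → FactorsThroughLinear e
chainImage⇒factorsThroughLinear {Z} {Z′} e chain =
  Y , chain , hom id (record { inj = id ; mono = mono }) , hom (fun e) (record { inj = inj ; mono = id }) , λ _ → refl
  where
  open IsHom (isHom e)
  pulledBack : FinPoset
  pulledBack = record
    { size = size Z ; _≼_ = λ x y → ALO._≼_ Z′ (fun e x) (fun e y)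
    ; ≼-dec = λ x y → ALO.≼-dec Z′ (fun e x) (fun e y)
    ; ≼-refl = λ x → ALO.≼-refl Z′ (fun e x)
    ; ≼-antisym = λ r s → inj (ALO.≼-antisym Z′ r s)
    ; ≼-trans = ALO.≼-trans Z′ }
  Y : ALO
  Y = record { poset = pulledBack ; almostLinear = total⇒almostLinear pulledBack chain }

factorsThroughLinear⇒chainImage : ∀ {Z Z′} (e : Hom Z Z′) → FactorsThroughLinear e → ChainImage e
factorsThroughLinear⇒chainImage {Z′ = Z′} e (Y , linY , u , v , vu≈e) p q =
  Sum.map (subst₂ (ALO._≼_ Z′) (vu≈e p) (vu≈e q) ∘ mono) (subst₂ (ALO._≼_ Z′) (vu≈e q) (vu≈e p) ∘ mono)
          (linY (fun u p) (fun u q))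
  where open IsHom (isHom v)

factorsThroughLinear⇒amalgamable : ∀ {Z Z′} (e : Hom Z Z′) → FactorsThroughLinear e → AmalgamableArrow e
factorsThroughLinear⇒amalgamable e (Y , linY , u , v , vu≈e) f g with linear-amalgamable Y linY (f ∘H v) (g ∘H v)
... | W , f′ , g′ , comm =
  W , f′ , g′ , λ z → subst (λ k → fun f′ (fun f k) ≡ fun g′ (fun g k)) (vu≈e z) (comm (fun u z))

Amalgamates : ∀ {Z Z′ Y₁ Y₂} → Hom Z Z′ → Hom Z′ Y₁ → Hom Z′ Y₂ → Set₁
Amalgamates {Y₁ = Y₁} {Y₂} e u₁ u₂ =
  Σ ALO λ W → Σ (Hom Y₁ W) λ F → Σ (Hom Y₂ W) λ G → ((F ∘H u₁) ∘H e) ≈ ((G ∘H u₂) ∘H e)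

-- In W both F (u₁ a) ≼ F (u₁ b) and F (u₁ b) = G (u₂ b) ≼ G (u₂ a) = F (u₁ a).
opposite-placements-collapse : ∀ {Y₁ Y₂ W} (F : Hom Y₁ W) (G : Hom Y₂ W) {a₁ b₁ a₂ b₂} →
  ALO._≼_ Y₁ a₁ b₁ → ALO._≼_ Y₂ b₂ a₂ → fun F a₁ ≡ fun G a₂ → fun F b₁ ≡ fun G b₂ → a₁ ≡ b₁
opposite-placements-collapse {W = W} F G a₁≼b₁ b₂≼a₂ Fa≡Ga Fb≡Gb = IsHom.inj (isHom F)
  (ALO.≼-antisym W (IsHom.mono (isHom F) a₁≼b₁)
                   (subst₂ (ALO._≼_ W) (sym Fb≡Gb) (sym Fa≡Ga) (IsHom.mono (isHom G) b₂≼a₂)))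

amalgamating-FintLO-placements⇒chainImage : ∀ {Z Z′} (e : Hom Z Z′) →
  (∀ {S₁ S₂} (u₁ : Hom Z′ (toALO S₁)) (u₂ : Hom Z′ (toALO S₂)) → Amalgamates e u₁ u₂) → ChainImage e
amalgamating-FintLO-placements⇒chainImage {Z′ = Z′} e amalgamate p q with comparable? Z′ (fun e p) (fun e q)
... | yes ep~eq = ep~eq
... | no ¬ep~eq =
  ⊥-elim (incomparable⇒≢ Z′ inc (collapse (placeBelow Z′ inc) (placeBelow Z′ (incomparable-sym Z′ inc))))
  where
  inc = ¬comparable⇒incomparable Z′ ¬ep~eq
  collapse : _ → _ → fun e p ≡ fun e q
  collapse (S₁ , u₁ , ep≼eq) (S₂ , u₂ , eq≼ep) with amalgamate u₁ u₂
  ... | W , F , G , comm = IsHom.inj (isHom u₁) (opposite-placements-collapse F G ep≼eq eq≼ep (comm p) (comm q))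

chainImage⇒¬fPlusB : ∀ {Z Z′} (e : Hom Z Z′) → ChainImage e → ¬ IsFPlusB e
chainImage⇒¬fPlusB {Z′ = Z′} e chain (d , d′ , ep≡p′ , eq≡q′ , _) =
  [ LplusB.p⋠q d′ ∘ subst₂ (ALO._≼_ Z′) ep≡p′ eq≡q′ , LplusB.q⋠p d′ ∘ subst₂ (ALO._≼_ Z′) eq≡q′ ep≡p′ ]′
    (chain (LplusB.p d) (LplusB.q d))

incomparable⇒LplusB : (X : ALO) {p q : Fin (size X)} → Incomparable X p q → LplusB X
incomparable⇒LplusB X {p} {q} inc@(p⋠q , q⋠p) = record
  { p = p ; q = q ; p≢q = incomparable⇒≢ X inc ; p⋠q = p⋠q ; q⋠p = q⋠p
  ; L-below = λ _ → incomparable-above X inc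
  ; L-linear = λ x y x≢p x≢q _ _ → comparable x y x≢p x≢q }
  where
  comparable : ∀ x y → x ≢ p → x ≢ q → Comparable X x y
  comparable x y x≢p x≢q with comparable? X x y
  ... | yes x~y = x~y
  ... | no ¬x~y = ⊥-elim ([ x≢p , x≢q ]′ (incomparable-unique X inc (¬comparable⇒incomparable X ¬x~y)))

¬fPlusB⇒chainImage : ∀ {Z Z′} (e : Hom Z Z′) → ¬ IsFPlusB e → ChainImage e
¬fPlusB⇒chainImage {Z} {Z′} e ¬fPlusB p q with comparable? Z′ (fun e p) (fun e q)
... | yes ep~eq = ep~eq
... | no ¬ep~eq = ⊥-elim (¬fPlusB
  ( incomparable⇒LplusB Z (hom-reflects-incomparable e inc) , incomparable⇒LplusB Z′ inc
  , refl , refl , λ _ x≢p x≢q → x≢p ∘ IsHom.inj (isHom e) , x≢q ∘ IsHom.inj (isHom e)))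
  where inc = ¬comparable⇒incomparable Z′ ¬ep~eq

amalgamable⇒chainImage : ∀ {Z Z′} (e : Hom Z Z′) → AmalgamableArrow e → ChainImage e
amalgamable⇒chainImage e amalgamable = amalgamating-FintLO-placements⇒chainImage e amalgamable

amalgamableInFintLO⇒chainImage : ∀ {S S′} (e : Emb S S′) → AmalgamableInFintLO e → ChainImage (toHom e)
amalgamableInFintLO⇒chainImage e amalgamable = amalgamating-FintLO-placements⇒chainImage (toHom e) λ u₁ u₂ →
  let U , F , G , comm = amalgamable (toEmb u₁) (toEmb u₂) in toALO U , toHom F , toHom G , comm

mainTheorem13 :
    ((X Y : ALO) → Linear X → Linear Y → (f : Fin (size X) → Fin (size Y)) → IsHom X Y f ⇔ IsOrderEmbedding X Y f)
    × ((X : ALO) → Σ ALO (λ Y → Linear Y × Hom X Y))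
    × ((S T : TStr) → (f : Fin (TStr.size S) → Fin (TStr.size T)) → IsEmb S T f ⇔ IsHom (toALO S) (toALO T) f)
    × ((X : ALO) → Σ TStr (λ S → Hom X (toALO S)))
    × ((X : ALO) → Linear X ⊎ InFintLO X)
    × ((X : ALO) → AmalgamableObj X ⇔ Linear X)
    × (∀ {Z Z'} (e : Hom Z Z') → (AmalgamableArrow e ⇔ FactorsThroughLinear e) × (FactorsThroughLinear e ⇔ (¬ IsFPlusB e)))
    × ((X : ALO) → ¬ InFintLO X → AmalgamableObj X)
    × (∀ {S S'} (e : Emb S S') → AmalgamableInFintLO e → Σ ALO (λ Y → AmalgamableObj Y × Σ (Hom (toALO S) Y) (λ a → Σ (Hom Y (toALO S')) (λ b → ∀ x → fun b (fun a x) ≡ efun e x))))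
mainTheorem13 =
    (λ X Y linX _ → FinLO-full X Y linX)
  , linearExtension
  , FintLO-full
  , FintLO-cofinal
  , linear⊎inFintLO
  -- ChainImage (idH X) unfolds to Linear X.
  , (λ X → mk⇔ (amalgamable⇒chainImage (idH X)) (linear-amalgamable X))
  , (λ e → mk⇔ (chainImage⇒factorsThroughLinear e ∘ amalgamable⇒chainImage e) (factorsThroughLinear⇒amalgamable e)
         , mk⇔ (chainImage⇒¬fPlusB e ∘ factorsThroughLinear⇒chainImage e)
               (chainImage⇒factorsThroughLinear e ∘ ¬fPlusB⇒chainImage e))
  , (λ X ¬inFintLO → linear-amalgamable X ([ id , ⊥-elim ∘ ¬inFintLO ]′ (linear⊎inFintLO X)))
  , λ e amalgamable →
      let Y , linY , factorization =
            chainImage⇒factorsThroughLinear (toHom e) (amalgamableInFintLO⇒chainImage e amalgamable)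
      in Y , linear-amalgamable Y linY , factorization
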